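{- Let $B$ and $B_0$ be symmetric nonnegative $k\times k$ matrices. Then $\delta_p(B,B_0)\le k^4\,\delta_{\mathrm{ds}}(B,B_0)$.
   Context: $\delta_p(B,B_0)=\frac1{k^2}\min_{\pi}\sum_{i,j\in[k]}(B(\pi(i),\pi(j))-B_0(i,j))^2$, the minimum over permutations $\pi$ of $[k]$. $\delta_{\mathrm{ds}}(B,B_0)=\min_{S}\frac1{k^2}\sum_{a,a',b,b'\in[k]}(B(a,b)-B_0(a',b'))^2S(a,a')S(b,b')$, the minimum over $k\times k$ doubly stochastic matrices $S$. -}

module Defs where

open import Level using (Level; _⊔_) renaming (suc to lsuc)
open import Algebra.Bundles using (CommutativeRing)
open import Data.Nat using (ℕ; zero; suc; _^_)
open import Data.Fin using (Fin)
open import Data.Fin.Permutation using (Permutation′; _⟨$⟩ʳ_)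
open import Data.Product using (_×_; ∃)
open import Relation.Binary using (Rel; IsTotalOrder)
open import Relation.Nullary using (¬_)

record OrderedField (c ℓ : Level) : Set (lsuc (c ⊔ ℓ)) where
  field
    commutativeRing : CommutativeRing c ℓ
  open CommutativeRing commutativeRing public
  field
    _≤_          : Rel Carrier ℓ
    isTotalOrder : IsTotalOrder _≈_ _≤_
    +-monoˡ-≤    : ∀ {x y} z → x ≤ y → (x + z) ≤ (y + z)
    *-nonneg     : ∀ {x y} → 0# ≤ x → 0# ≤ y → 0# ≤ (x * y)
    _⁻¹          : Carrier → Carrier
    ⁻¹-inverse   : ∀ x → ¬ (x ≈ 0#) → (x * (x ⁻¹)) ≈ 1#
    0≉1          : ¬ (0# ≈ 1#)

module _ {c ℓ : Level} (F : OrderedField c ℓ) where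
  open OrderedField F

  ∑ : ∀ {n} → (Fin n → Carrier) → Carrier
  ∑ {zero}  f = 0#
  ∑ {suc n} f = f Fin.zero + ∑ (λ i → f (Fin.suc i))

  fromℕ : ℕ → Carrier
  fromℕ zero    = 0#
  fromℕ (suc n) = 1# + fromℕ n

  sq : Carrier → Carrier
  sq x = x * x

  Matrix : ℕ → Set c
  Matrix k = Fin k → Fin k → Carrier

  Symmetric : ∀ {k} → Matrix k → Set ℓ
  Symmetric B = ∀ i j → B i j ≈ B j i

  Nonnegative : ∀ {k} → Matrix k → Set ℓ
  Nonnegative B = ∀ i j → 0# ≤ B i j

  DoublyStochastic : ∀ {k} → Matrix k → Set ℓ
  DoublyStochastic {k} S =
    Nonnegative S
    × (∀ i → ∑ (λ j → S i j) ≈ 1#)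
    × (∀ j → ∑ (λ i → S i j) ≈ 1#)

  δp-at : ∀ {k} → Matrix k → Matrix k → Permutation′ k → Carrier
  δp-at {k} B B₀ π =
    (fromℕ (k ^ 2) ⁻¹) *
      ∑ (λ i → ∑ (λ j → sq (B (π ⟨$⟩ʳ i) (π ⟨$⟩ʳ j) - B₀ i j)))

  -- δ_p(B,B₀) ≤ x  (δ_p is the minimum over permutations π of δp-at)
  δp-≤ : ∀ {k} → Matrix k → Matrix k → Carrier → Set ℓ
  δp-≤ B B₀ x = ∃ λ π → δp-at B B₀ π ≤ x

  δds-at : ∀ {k} → Matrix k → Matrix k → Matrix k → Carrier
  δds-at {k} B B₀ S =
    (fromℕ (k ^ 2) ⁻¹) *
      ∑ (λ a → ∑ (λ a' → ∑ (λ b → ∑ (λ b' →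
        (sq (B a b - B₀ a' b') * S a a') * S b b'))))

{-# OPTIONS --safe #-}

-- Hall's theorem gives every doubly stochastic k × k matrix S a permutation π with
-- S (π i) i ≥ 1/k² for all i: in the bipartite graph of the entries ≥ 1/k², a set A of
-- columns with neighbourhood N(A) carries mass |A| ≤ |N(A)| + |A| (k - |N(A)|) / k², which
-- forces |A| ≤ |N(A)| once k ≥ 2. Keeping in the sum defining δ_ds(B,B₀) only the terms with
-- a = π a′ and b = π b′, whose weights S(a,a′) S(b,b′) are at least 1/k⁴, bounds it from
-- below by δ_p(B,B₀) / k⁴.
module Submission where

open import Defs
open import Level using (Level)
open import Data.Nat using (ℕ; _^_)
open import Data.Product using (_,_; proj₁)

module HallMarriage where

  open import Data.Nat using (zero; suc; _+_; _≤_; _<_; _<?_; z≤n; s≤s)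
  open import Data.Nat.Properties
    using (≤-refl; ≤-trans; <⇒≱; ≮⇒≥; m≤m+n; +-suc; +-comm; +-mono-≤; +-mono-<-≤; +-mono-≤-<;
           module ≤-Reasoning)
  open import Data.Nat.Induction using (<-wellFounded)
  open import Data.Fin using (Fin; zero; suc; _≟_; punchOut)
  open import Data.Fin.Properties using (any?; punchOut-injective; injective⇒≤)
  open import Data.Fin.Subset
    using (Subset; _∈_; _∉_; _⊆_; _∪_; _∩_; _-_; ⁅_⁆; ∣_∣; Nonempty; inside; outside)
    renaming (⊥ to ∅)
  open import Data.Fin.Subset.Properties
    using (_∈?_; anySubset?; nonempty?; Empty-unique; ∣⊥∣≡0; ∉⊥; x∈⁅x⁆; x∈⁅y⁆⇒x≡y; x≢y⇒x∉⁅y⁆;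
           ∣⁅x⁆∣≡1; x∈p∪q⁺; x∈p∪q⁻; x∈p∩q⁺; x∈p∩q⁻; p─q⊆p; x∈p∧x≢y⇒x∈p-y; x∈p⇒∣p-x∣<∣p∣;
           p⊆q⇒∣p∣≤∣q∣; p⊂q⇒∣p∣<∣q∣; p⊆p∪q; q⊆p∪q)
  open import Data.Fin.Permutation using (Permutation′; _⟨$⟩ʳ_; permutation)
  open import Data.Vec using (_∷_; [])
  open import Data.Vec.Base using (here; there)
  open import Data.Vec.Functional using (updateAt)
  open import Data.Vec.Functional.Properties using (updateAt-updates; updateAt-minimal)
  open import Data.Product using (Σ; ∃; ∃₂; _×_; proj₂)
  open import Data.Sum using (_⊎_; inj₁; inj₂)
  open import Data.Empty using (⊥; ⊥-elim)
  open import Function using (_∘_)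
  open import Function.Definitions using (Injective)
  open import Induction.WellFounded using (Acc; acc)
  open import Relation.Nullary using (Dec; yes; no; ¬?; contradiction)
  open import Relation.Nullary.Decidable using (_×-dec_; decidable-stable)
  open import Relation.Binary.PropositionalEquality
    using (_≡_; _≢_; refl; sym; trans; cong; subst)

  private variable n m : ℕ

  ∣p∪q∣+∣p∩q∣≡∣p∣+∣q∣ : (p q : Subset n) → ∣ p ∪ q ∣ + ∣ p ∩ q ∣ ≡ ∣ p ∣ + ∣ q ∣
  ∣p∪q∣+∣p∩q∣≡∣p∣+∣q∣ [] [] = refl
  ∣p∪q∣+∣p∩q∣≡∣p∣+∣q∣ (inside ∷ p) (inside ∷ q) =
    cong suc (trans (+-suc _ _) (trans (cong suc (∣p∪q∣+∣p∩q∣≡∣p∣+∣q∣ p q)) (sym (+-suc _ _))))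
  ∣p∪q∣+∣p∩q∣≡∣p∣+∣q∣ (inside ∷ p) (outside ∷ q) = cong suc (∣p∪q∣+∣p∩q∣≡∣p∣+∣q∣ p q)
  ∣p∪q∣+∣p∩q∣≡∣p∣+∣q∣ (outside ∷ p) (inside ∷ q) =
    trans (cong suc (∣p∪q∣+∣p∩q∣≡∣p∣+∣q∣ p q)) (sym (+-suc _ _))
  ∣p∪q∣+∣p∩q∣≡∣p∣+∣q∣ (outside ∷ p) (outside ∷ q) = ∣p∪q∣+∣p∩q∣≡∣p∣+∣q∣ p q

  ∣p∪q∣≤∣p∣+∣q∣ : (p q : Subset n) → ∣ p ∪ q ∣ ≤ ∣ p ∣ + ∣ q ∣
  ∣p∪q∣≤∣p∣+∣q∣ p q = subst (∣ p ∪ q ∣ ≤_) (∣p∪q∣+∣p∩q∣≡∣p∣+∣q∣ p q) (m≤m+n _ _)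

  ∣p∣≤1+∣p-x∣ : (p : Subset n) (x : Fin n) → ∣ p ∣ ≤ suc ∣ p - x ∣
  ∣p∣≤1+∣p-x∣ p x = begin
    ∣ p ∣                  ≤⟨ p⊆q⇒∣p∣≤∣q∣ p⊆[p-x]∪⁅x⁆ ⟩
    ∣ (p - x) ∪ ⁅ x ⁆ ∣    ≤⟨ ∣p∪q∣≤∣p∣+∣q∣ (p - x) ⁅ x ⁆ ⟩
    ∣ p - x ∣ + ∣ ⁅ x ⁆ ∣  ≡⟨ cong (∣ p - x ∣ +_) (∣⁅x⁆∣≡1 x) ⟩
    ∣ p - x ∣ + 1          ≡⟨ +-comm ∣ p - x ∣ 1 ⟩
    suc ∣ p - x ∣          ∎
    where
    open ≤-Reasoning
    p⊆[p-x]∪⁅x⁆ : p ⊆ (p - x) ∪ ⁅ x ⁆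
    p⊆[p-x]∪⁅x⁆ {y} y∈p with y ≟ x
    ... | yes refl = q⊆p∪q (p - x) ⁅ x ⁆ (x∈⁅x⁆ x)
    ... | no y≢x   = p⊆p∪q ⁅ x ⁆ (x∈p∧x≢y⇒x∈p-y y∈p y≢x)

  x∈p-y⇒x≢y : ∀ {p : Subset n} {x y} → x ∈ p - y → x ≢ y
  x∈p-y⇒x≢y {p = p} {y = y} x∈p-y refl = x∉p-x p y x∈p-y
    where
    x∉p-x : (p : Subset n) (x : Fin n) → x ∉ p - x
    x∉p-x (_ ∷ p) (suc x) (there x∈) = x∉p-x p x x∈

  1≤∣p∣⇒Nonempty : {p : Subset n} → 1 ≤ ∣ p ∣ → Nonempty p
  1≤∣p∣⇒Nonempty {n} {p} 1≤∣p∣ with nonempty? p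
  ... | yes ne = ne
  ... | no ¬ne with () ← subst (1 ≤_) (trans (cong ∣_∣ (Empty-unique ¬ne)) (∣⊥∣≡0 n)) 1≤∣p∣

  Graph : ℕ → ℕ → Set
  Graph n m = Fin n → Subset m

  N : Graph n m → Subset n → Subset m
  N {zero}  E []            = ∅
  N {suc n} E (outside ∷ A) = N (E ∘ suc) A
  N {suc n} E (inside ∷ A)  = E zero ∪ N (E ∘ suc) A

  y∈N⁺ : (E : Graph n m) {A : Subset n} {x : Fin n} {y : Fin m} → x ∈ A → y ∈ E x → y ∈ N E A
  y∈N⁺ E {inside ∷ A} {zero} here y∈Ex = x∈p∪q⁺ (inj₁ y∈Ex)
  y∈N⁺ E {inside ∷ A} {suc x} (there x∈A) y∈Ex = x∈p∪q⁺ (inj₂ (y∈N⁺ (E ∘ suc) x∈A y∈Ex))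
  y∈N⁺ E {outside ∷ A} {suc x} (there x∈A) y∈Ex = y∈N⁺ (E ∘ suc) x∈A y∈Ex

  y∈N⁻ : (E : Graph n m) (A : Subset n) {y : Fin m} → y ∈ N E A → ∃ λ x → x ∈ A × y ∈ E x
  y∈N⁻ {zero} E [] y∈ = contradiction y∈ ∉⊥
  y∈N⁻ {suc n} E (outside ∷ A) y∈ with x , x∈A , y∈Ex ← y∈N⁻ (E ∘ suc) A y∈ = suc x , there x∈A , y∈Ex
  y∈N⁻ {suc n} E (inside ∷ A) y∈ with x∈p∪q⁻ (E zero) (N (E ∘ suc) A) y∈
  ... | inj₁ y∈E0 = zero , here , y∈E0
  ... | inj₂ y∈N with x , x∈A , y∈Ex ← y∈N⁻ (E ∘ suc) A y∈N = suc x , there x∈A , y∈Ex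

  N-mono : (E E′ : Graph n m) {A A′ : Subset n} →
           A ⊆ A′ → (∀ {x} → x ∈ A → E x ⊆ E′ x) → N E A ⊆ N E′ A′
  N-mono E E′ {A} A⊆A′ E⊆E′ y∈ with x , x∈A , y∈Ex ← y∈N⁻ E A y∈ = y∈N⁺ E′ (A⊆A′ x∈A) (E⊆E′ x∈A y∈Ex)

  Hall : Graph n m → Set
  Hall {n} E = (A : Subset n) → ∣ A ∣ ≤ ∣ N E A ∣

  Violator : Graph n m → Subset n → Set
  Violator E A = ∣ N E A ∣ < ∣ A ∣

  Hall⊎Violator : (E : Graph n m) → Hall E ⊎ ∃ (Violator E)
  Hall⊎Violator E with anySubset? (λ A → ∣ N E A ∣ <? ∣ A ∣)
  ... | yes violator = inj₂ violator
  ... | no ¬violator = inj₁ (λ A → ≮⇒≥ (λ v → ¬violator (A , v)))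

  Matching : Graph n m → Set
  Matching {n} {m} E = Σ (Fin n → Fin m) λ f → (∀ x → f x ∈ E x) × Injective _≡_ _≡_ f

  removeEdge : Graph n m → Fin n → Fin m → Graph n m
  removeEdge E r c = updateAt E r (_- c)

  removeEdge-⊆ : (E : Graph n m) (r : Fin n) (c : Fin m) (x : Fin n) → removeEdge E r c x ⊆ E x
  removeEdge-⊆ E r c x with x ≟ r
  ... | yes refl = λ y∈ → p─q⊆p (E r) ⁅ c ⁆ (subst (_ ∈_) (updateAt-updates r E) y∈)
  ... | no x≢r   = subst (_ ∈_) (updateAt-minimal x r E x≢r)

  ∈removeEdge-away : (E : Graph n m) {r x : Fin n} (c : Fin m) {y : Fin m} →
                     x ≢ r → y ∈ E x → y ∈ removeEdge E r c x
  ∈removeEdge-away E {r} {x} c x≢r = subst (_ ∈_) (sym (updateAt-minimal x r E x≢r))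

  ∈removeEdge-other : (E : Graph n m) (r x : Fin n) {c y : Fin m} →
                      y ≢ c → y ∈ E x → y ∈ removeEdge E r c x
  ∈removeEdge-other E r x y≢c y∈Ex with x ≟ r
  ... | yes refl = subst (_ ∈_) (sym (updateAt-updates r E)) (x∈p∧x≢y⇒x∈p-y y∈Ex y≢c)
  ... | no x≢r   = ∈removeEdge-away E _ x≢r y∈Ex

  edgeCount : Graph n m → ℕ
  edgeCount {zero}  E = 0
  edgeCount {suc n} E = ∣ E zero ∣ + edgeCount (E ∘ suc)

  edgeCount-mono : (E E′ : Graph n m) → (∀ x → E x ⊆ E′ x) → edgeCount E ≤ edgeCount E′
  edgeCount-mono {zero}  E E′ E⊆E′ = z≤n
  edgeCount-mono {suc n} E E′ E⊆E′ =
    +-mono-≤ (p⊆q⇒∣p∣≤∣q∣ (E⊆E′ zero)) (edgeCount-mono (E ∘ suc) (E′ ∘ suc) (E⊆E′ ∘ suc))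

  edgeCount-mono-< : (E E′ : Graph n m) → (∀ x → E x ⊆ E′ x) →
                     (r : Fin n) → ∣ E r ∣ < ∣ E′ r ∣ → edgeCount E < edgeCount E′
  edgeCount-mono-< E E′ E⊆E′ zero lt =
    +-mono-<-≤ lt (edgeCount-mono (E ∘ suc) (E′ ∘ suc) (E⊆E′ ∘ suc))
  edgeCount-mono-< E E′ E⊆E′ (suc r) lt =
    +-mono-≤-< (p⊆q⇒∣p∣≤∣q∣ (E⊆E′ zero)) (edgeCount-mono-< (E ∘ suc) (E′ ∘ suc) (E⊆E′ ∘ suc) r lt)

  edgeCount-removeEdge-< : (E : Graph n m) {r : Fin n} {c : Fin m} →
                         c ∈ E r → edgeCount (removeEdge E r c) < edgeCount E
  edgeCount-removeEdge-< E {r} {c} c∈Er = edgeCount-mono-< _ E (removeEdge-⊆ E r c) r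
    (subst (λ p → ∣ p ∣ < ∣ E r ∣) (sym (updateAt-updates r E)) (x∈p⇒∣p-x∣<∣p∣ c∈Er))

  module _ {E : Graph n m} (hall : Hall E) {r : Fin n} where

    r∈violator : ∀ {c A} → Violator (removeEdge E r c) A → r ∈ A
    r∈violator {c} {A} violator with r ∈? A
    ... | yes r∈A = r∈A
    ... | no  r∉A = contradiction (≤-trans (hall A) (p⊆q⇒∣p∣≤∣q∣ N⊆N′)) (<⇒≱ violator)
      where
      N⊆N′ : N E A ⊆ N (removeEdge E r c) A
      N⊆N′ = N-mono E _ (λ x∈A → x∈A) λ x∈A → ∈removeEdge-away E c (λ { refl → r∉A x∈A })

    -- Rado's argument: violators A₁, A₂ of the two deletions would make A₁ ∪ A₂ and
    -- A₁ ∩ A₂ - r together violate the Hall condition of E.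
    no-two-violators : ∀ {c₁ c₂ A₁ A₂} → c₁ ≢ c₂ →
                       Violator (removeEdge E r c₁) A₁ → Violator (removeEdge E r c₂) A₂ → ⊥
    no-two-violators {c₁} {c₂} {A₁} {A₂} c₁≢c₂ v₁ v₂ = <⇒≱ ≤-refl counting
      where
      X₁ = N (removeEdge E r c₁) A₁
      X₂ = N (removeEdge E r c₂) A₂

      N[A₁∪A₂]⊆X₁∪X₂ : N E (A₁ ∪ A₂) ⊆ X₁ ∪ X₂
      N[A₁∪A₂]⊆X₁∪X₂ {y} y∈ with x , x∈ , y∈Ex ← y∈N⁻ E (A₁ ∪ A₂) y∈ | x ≟ r | y ≟ c₁
      ... | yes refl | yes refl =
        x∈p∪q⁺ (inj₂ (y∈N⁺ _ (r∈violator v₂) (∈removeEdge-other E r r c₁≢c₂ y∈Ex)))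
      ... | yes refl | no y≢c₁ =
        x∈p∪q⁺ (inj₁ (y∈N⁺ _ (r∈violator v₁) (∈removeEdge-other E r r y≢c₁ y∈Ex)))
      ... | no x≢r | _ with x∈p∪q⁻ A₁ A₂ x∈
      ...   | inj₁ x∈A₁ = x∈p∪q⁺ (inj₁ (y∈N⁺ _ x∈A₁ (∈removeEdge-away E c₁ x≢r y∈Ex)))
      ...   | inj₂ x∈A₂ = x∈p∪q⁺ (inj₂ (y∈N⁺ _ x∈A₂ (∈removeEdge-away E c₂ x≢r y∈Ex)))

      N[A₁∩A₂-r]⊆X₁∩X₂ : N E (A₁ ∩ A₂ - r) ⊆ X₁ ∩ X₂
      N[A₁∩A₂-r]⊆X₁∩X₂ y∈ = x∈p∩q⁺ (N-mono E _ A⊆A₁ E⊆E₁ y∈ , N-mono E _ A⊆A₂ E⊆E₂ y∈)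
        where
        A⊆A₁ : A₁ ∩ A₂ - r ⊆ A₁
        A⊆A₁ x∈ = proj₁ (x∈p∩q⁻ A₁ A₂ (p─q⊆p _ _ x∈))
        A⊆A₂ : A₁ ∩ A₂ - r ⊆ A₂
        A⊆A₂ x∈ = proj₂ (x∈p∩q⁻ A₁ A₂ (p─q⊆p _ _ x∈))
        E⊆E₁ : ∀ {x} → x ∈ A₁ ∩ A₂ - r → E x ⊆ removeEdge E r c₁ x
        E⊆E₁ x∈ = ∈removeEdge-away E c₁ (x∈p-y⇒x≢y x∈)
        E⊆E₂ : ∀ {x} → x ∈ A₁ ∩ A₂ - r → E x ⊆ removeEdge E r c₂ x
        E⊆E₂ x∈ = ∈removeEdge-away E c₂ (x∈p-y⇒x≢y x∈)

      open ≤-Reasoning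
      counting : suc (suc (∣ X₁ ∣ + ∣ X₂ ∣)) ≤ suc (∣ X₁ ∣ + ∣ X₂ ∣)
      counting = begin
        suc (suc (∣ X₁ ∣ + ∣ X₂ ∣))           ≡⟨ cong suc (+-suc _ _) ⟨
        suc ∣ X₁ ∣ + suc ∣ X₂ ∣               ≤⟨ +-mono-≤ v₁ v₂ ⟩
        ∣ A₁ ∣ + ∣ A₂ ∣                       ≡⟨ ∣p∪q∣+∣p∩q∣≡∣p∣+∣q∣ A₁ A₂ ⟨
        ∣ A₁ ∪ A₂ ∣ + ∣ A₁ ∩ A₂ ∣             ≤⟨ +-mono-≤ (hall (A₁ ∪ A₂)) (∣p∣≤1+∣p-x∣ (A₁ ∩ A₂) r) ⟩
        ∣ N E (A₁ ∪ A₂) ∣ + suc ∣ A₁ ∩ A₂ - r ∣ ≤⟨ +-mono-≤ (p⊆q⇒∣p∣≤∣q∣ N[A₁∪A₂]⊆X₁∪X₂)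
                                                   (s≤s (≤-trans (hall _) (p⊆q⇒∣p∣≤∣q∣ N[A₁∩A₂-r]⊆X₁∩X₂))) ⟩
        ∣ X₁ ∪ X₂ ∣ + suc ∣ X₁ ∩ X₂ ∣         ≡⟨ +-suc _ _ ⟩
        suc (∣ X₁ ∪ X₂ ∣ + ∣ X₁ ∩ X₂ ∣)       ≡⟨ cong suc (∣p∪q∣+∣p∩q∣≡∣p∣+∣q∣ X₁ X₂) ⟩
        suc (∣ X₁ ∣ + ∣ X₂ ∣)                 ∎

    Hall⇒removeEdge-Hall : ∀ {c₁ c₂} → c₁ ≢ c₂ → Hall (removeEdge E r c₁) ⊎ Hall (removeEdge E r c₂)
    Hall⇒removeEdge-Hall c₁≢c₂ with Hall⊎Violator (removeEdge E r _) | Hall⊎Violator (removeEdge E r _)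
    ... | inj₁ hall₁ | _ = inj₁ hall₁
    ... | inj₂ _ | inj₁ hall₂ = inj₂ hall₂
    ... | inj₂ (_ , v₁) | inj₂ (_ , v₂) = ⊥-elim (no-two-violators c₁≢c₂ v₁ v₂)

  Hall⇒neighbour : {E : Graph n m} → Hall E → ∀ x → ∃ (_∈ E x)
  Hall⇒neighbour {E = E} hall x
    with y , y∈ ← 1≤∣p∣⇒Nonempty (subst (_≤ ∣ N E ⁅ x ⁆ ∣) (∣⁅x⁆∣≡1 x) (hall ⁅ x ⁆))
    with x′ , x′∈⁅x⁆ , y∈Ex′ ← y∈N⁻ E ⁅ x ⁆ y∈
    = y , subst (λ z → y ∈ E z) (x∈⁅y⁆⇒x≡y x x′∈⁅x⁆) y∈Ex′

  UniqueNeighbours : Graph n m → Set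
  UniqueNeighbours E = ∀ x {c₁ c₂} → c₁ ∈ E x → c₂ ∈ E x → c₁ ≡ c₂

  Hall∧UniqueNeighbours⇒Matching : {E : Graph n m} → Hall E → UniqueNeighbours E → Matching E
  Hall∧UniqueNeighbours⇒Matching {n} {m} {E} hall unique = f , f∈E , f-injective
    where
    f : Fin n → Fin m
    f x = proj₁ (Hall⇒neighbour hall x)
    f∈E : ∀ x → f x ∈ E x
    f∈E x = proj₂ (Hall⇒neighbour hall x)

    -- Two vertices with the same unique neighbour would violate Hall on the pair.
    f-injective : Injective _≡_ _≡_ f
    f-injective {x} {y} fx≡fy = decidable-stable (x ≟ y) λ x≢y →
      <⇒≱ (1<∣⁅x⁆∪⁅y⁆∣ x≢y) (≤-trans (hall (⁅ x ⁆ ∪ ⁅ y ⁆)) ∣N⁅x,y⁆∣≤1)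
      where
      1<∣⁅x⁆∪⁅y⁆∣ : x ≢ y → 1 < ∣ ⁅ x ⁆ ∪ ⁅ y ⁆ ∣
      1<∣⁅x⁆∪⁅y⁆∣ x≢y = subst (_< ∣ ⁅ x ⁆ ∪ ⁅ y ⁆ ∣) (∣⁅x⁆∣≡1 x) (p⊂q⇒∣p∣<∣q∣
        (p⊆p∪q ⁅ y ⁆ , y , q⊆p∪q ⁅ x ⁆ ⁅ y ⁆ (x∈⁅x⁆ y) , x≢y⇒x∉⁅y⁆ (x≢y ∘ sym)))
      N⁅x,y⁆⊆⁅fx⁆ : N E (⁅ x ⁆ ∪ ⁅ y ⁆) ⊆ ⁅ f x ⁆
      N⁅x,y⁆⊆⁅fx⁆ z∈ with w , w∈ , z∈Ew ← y∈N⁻ E (⁅ x ⁆ ∪ ⁅ y ⁆) z∈ | x∈p∪q⁻ ⁅ x ⁆ ⁅ y ⁆ w∈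
      ... | inj₁ w∈⁅x⁆ rewrite x∈⁅y⁆⇒x≡y x w∈⁅x⁆ = subst (_∈ ⁅ f x ⁆) (unique x (f∈E x) z∈Ew) (x∈⁅x⁆ (f x))
      ... | inj₂ w∈⁅y⁆ rewrite x∈⁅y⁆⇒x≡y y w∈⁅y⁆ =
        subst (_∈ ⁅ f x ⁆) (trans fx≡fy (unique y (f∈E y) z∈Ew)) (x∈⁅x⁆ (f x))
      ∣N⁅x,y⁆∣≤1 : ∣ N E (⁅ x ⁆ ∪ ⁅ y ⁆) ∣ ≤ 1
      ∣N⁅x,y⁆∣≤1 = subst (_ ≤_) (∣⁅x⁆∣≡1 (f x)) (p⊆q⇒∣p∣≤∣q∣ N⁅x,y⁆⊆⁅fx⁆)

  removeEdge-Matching⇒Matching : {E : Graph n m} {r : Fin n} {c : Fin m} →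
                                 Matching (removeEdge E r c) → Matching E
  removeEdge-Matching⇒Matching {E = E} {r} {c} (f , f∈E′ , f-injective) =
    f , (λ x → removeEdge-⊆ E r c x (f∈E′ x)) , f-injective

  TwoNeighbours : Graph n m → Fin n → Set
  TwoNeighbours E x = ∃₂ λ c₁ c₂ → c₁ ∈ E x × c₂ ∈ E x × c₁ ≢ c₂

  twoNeighbours? : (E : Graph n m) (x : Fin n) → Dec (TwoNeighbours E x)
  twoNeighbours? E x = any? λ c₁ → any? λ c₂ → c₁ ∈? E x ×-dec c₂ ∈? E x ×-dec ¬? (c₁ ≟ c₂)

  -- Deleting edges while preserving the Hall condition ends at a graph of unique neighbours.
  Hall⇒Matching : (E : Graph n m) → Hall E → Matching E
  Hall⇒Matching E = go E (<-wellFounded (edgeCount E))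
    where
    go : (E : Graph n m) → Acc _<_ (edgeCount E) → Hall E → Matching E
    go E (acc smaller) hall with any? (twoNeighbours? E)
    ... | no none = Hall∧UniqueNeighbours⇒Matching hall λ x {c₁} {c₂} c₁∈ c₂∈ →
      decidable-stable (c₁ ≟ c₂) λ c₁≢c₂ → none (x , c₁ , c₂ , c₁∈ , c₂∈ , c₁≢c₂)
    ... | yes (r , c₁ , c₂ , c₁∈ , c₂∈ , c₁≢c₂) with Hall⇒removeEdge-Hall hall c₁≢c₂
    ...   | inj₁ hall₁ =
      removeEdge-Matching⇒Matching (go _ (smaller (edgeCount-removeEdge-< E c₁∈)) hall₁)
    ...   | inj₂ hall₂ =
      removeEdge-Matching⇒Matching (go _ (smaller (edgeCount-removeEdge-< E c₂∈)) hall₂)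

  injective⇒surjective : (f : Fin n → Fin n) → Injective _≡_ _≡_ f → ∀ y → ∃ λ x → f x ≡ y
  injective⇒surjective {zero} f f-injective ()
  injective⇒surjective {suc n} f f-injective y with any? (λ x → f x ≟ y)
  ... | yes preimage = preimage
  ... | no  ¬preimage = contradiction (injective⇒≤ g-injective) λ { (s≤s n+1≤n) → <⇒≱ ≤-refl n+1≤n }
    where
    y≢f : ∀ x → y ≢ f x
    y≢f x y≡fx = ¬preimage (x , sym y≡fx)
    g : Fin (suc n) → Fin n
    g x = punchOut (y≢f x)
    g-injective : Injective _≡_ _≡_ g
    g-injective = f-injective ∘ punchOut-injective (y≢f _) (y≢f _)

  injective⇒permutation : (f : Fin n → Fin n) → Injective _≡_ _≡_ f →
                          Σ (Permutation′ n) λ π → ∀ i → π ⟨$⟩ʳ i ≡ f i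
  injective⇒permutation f f-injective =
    permutation f (proj₁ ∘ surjective) (proj₂ ∘ surjective)
                (λ x → f-injective (proj₂ (surjective (f x)))) ,
    λ _ → refl
    where surjective = injective⇒surjective f f-injective

module ThresholdArithmetic where

  open import Data.Nat
  open import Data.Nat.Properties
  open import Data.Nat.Tactic.RingSolver using (solve-∀)
  open import Relation.Nullary using (contradiction)
  open import Relation.Nullary.Decidable using (decidable-stable)
  open import Relation.Binary.PropositionalEquality

  -- k * (k * 1) is how k ^ 2 unfolds.
  a*k*k≡k²*a : ∀ a k → a * k * k ≡ k * (k * 1) * a
  a*k*k≡k²*a = solve-∀

  k²[1+ν]+k*k≡k²[2+ν] : ∀ k ν → k * (k * 1) * (1 + ν) + k * k ≡ k * (k * 1) * (2 + ν)
  k²[1+ν]+k*k≡k²[2+ν] = solve-∀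

  threshold-arithmetic : ∀ {k a ν} → 2 ≤ k → a ≤ k → k ^ 2 * a ≤ k ^ 2 * ν + a * (k ∸ ν) → a ≤ ν
  threshold-arithmetic {k@(suc k-1@(suc _))} {a} {ν} 1<k@(s≤s (s≤s z≤n)) a≤k ineq =
    decidable-stable (a ≤? ν) λ a≰ν → contradiction ineq (<⇒≱ (deficit ν (≰⇒> a≰ν)))
    where
    open ≤-Reasoning
    deficit : ∀ ν → ν < a → k ^ 2 * ν + a * (k ∸ ν) < k ^ 2 * a
    deficit zero (s≤s _) = begin-strict
      k ^ 2 * 0 + a * k   ≡⟨ cong (_+ a * k) (*-zeroʳ (k ^ 2)) ⟩
      a * k               <⟨ m<m*n (a * k) k 1<k ⟩
      a * k * k           ≡⟨ a*k*k≡k²*a a k ⟩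
      k ^ 2 * a           ∎
    deficit (suc ν) ν<a = begin-strict
      k ^ 2 * suc ν + a * (k ∸ suc ν)   ≤⟨ +-monoʳ-≤ (k ^ 2 * suc ν)
                                             (*-mono-≤ a≤k (∸-monoʳ-≤ {1} {suc ν} k (s≤s z≤n))) ⟩
      k ^ 2 * suc ν + k * (k ∸ 1)       <⟨ +-monoʳ-< (k ^ 2 * suc ν) (*-monoʳ-< k {k-1} ≤-refl) ⟩
      k ^ 2 * suc ν + k * k             ≡⟨ k²[1+ν]+k*k≡k²[2+ν] k ν ⟩
      k ^ 2 * suc (suc ν)               ≤⟨ *-monoʳ-≤ (k ^ 2) ν<a ⟩
      k ^ 2 * a                         ∎

module OrderedFieldProperties {c ℓ : Level} (F : OrderedField c ℓ) where

  open import Data.Nat as ℕ using (zero; suc)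
  open import Data.Fin using (Fin; zero; suc)
  open import Data.Sum using (inj₁; inj₂)
  open import Function using (_∘_)
  open import Relation.Binary using (IsTotalOrder; Poset)
  open import Relation.Nullary using (¬_; contradiction)
  import Relation.Binary.PropositionalEquality as ≡
  import Algebra.Properties.Ring as RingProperties
  import Algebra.Properties.Semiring.Sum as SemiringSum
  import Relation.Binary.Reasoning.PartialOrder as PosetReasoning

  open OrderedField F hiding (_≤_; zero)

  -- The field's order, re-declared with the usual fixity (Defs gives it none).
  infix 4 _≤_
  _≤_ : Carrier → Carrier → Set ℓ
  _≤_ = OrderedField._≤_ F
  open IsTotalOrder isTotalOrder public
    using (total; antisym) renaming (refl to ≤-refl; trans to ≤-trans; reflexive to ≤-reflexive)
  open RingProperties ring using (-‿distribˡ-*; -‿distribʳ-*; -‿involutive; x[y-z]≈xy-xz)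

  poset : Poset c ℓ ℓ
  poset = record { isPartialOrder = IsTotalOrder.isPartialOrder isTotalOrder }

  open PosetReasoning poset public

  +-monoʳ-≤ : ∀ {x y} z → x ≤ y → z + x ≤ z + y
  +-monoʳ-≤ {x} {y} z x≤y = begin
    z + x  ≈⟨ +-comm z x ⟩
    x + z  ≤⟨ +-monoˡ-≤ z x≤y ⟩
    y + z  ≈⟨ +-comm y z ⟩
    z + y  ∎

  +-mono-≤ : ∀ {x y u v} → x ≤ y → u ≤ v → x + u ≤ y + v
  +-mono-≤ {y = y} {u} x≤y u≤v = ≤-trans (+-monoˡ-≤ u x≤y) (+-monoʳ-≤ y u≤v)

  +-cancelˡ-≤ : ∀ x {y z} → x + y ≤ x + z → y ≤ z
  +-cancelˡ-≤ x {y} {z} x+y≤x+z = begin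
    y                ≈⟨ lemma y ⟨
    - x + (x + y)    ≤⟨ +-monoʳ-≤ (- x) x+y≤x+z ⟩
    - x + (x + z)    ≈⟨ lemma z ⟩
    z                ∎
    where
    lemma : ∀ w → - x + (x + w) ≈ w
    lemma w = trans (sym (+-assoc (- x) x w)) (trans (+-congʳ (-‿inverseˡ x)) (+-identityˡ w))

  x≤y⇒0≤y-x : ∀ {x y} → x ≤ y → 0# ≤ y - x
  x≤y⇒0≤y-x {x} {y} x≤y = begin
    0#      ≈⟨ -‿inverseʳ x ⟨
    x - x   ≤⟨ +-monoˡ-≤ (- x) x≤y ⟩
    y - x   ∎

  0≤y-x⇒x≤y : ∀ {x y} → 0# ≤ y - x → x ≤ y
  0≤y-x⇒x≤y {x} {y} 0≤y-x = +-cancelˡ-≤ (- x) (begin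
    - x + x   ≈⟨ -‿inverseˡ x ⟩
    0#        ≤⟨ 0≤y-x ⟩
    y - x     ≈⟨ +-comm y (- x) ⟩
    - x + y   ∎)

  *-monoˡ-≤-nonneg : ∀ {z x y} → 0# ≤ z → x ≤ y → z * x ≤ z * y
  *-monoˡ-≤-nonneg {z} {x} {y} 0≤z x≤y =
    0≤y-x⇒x≤y (≤-trans (*-nonneg 0≤z (x≤y⇒0≤y-x x≤y)) (≤-reflexive (x[y-z]≈xy-xz z y x)))

  *-monoʳ-≤-nonneg : ∀ {z x y} → 0# ≤ z → x ≤ y → x * z ≤ y * z
  *-monoʳ-≤-nonneg {z} {x} {y} 0≤z x≤y = begin
    x * z   ≈⟨ *-comm x z ⟩
    z * x   ≤⟨ *-monoˡ-≤-nonneg 0≤z x≤y ⟩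
    z * y   ≈⟨ *-comm z y ⟩
    y * z   ∎

  x≤0⇒0≤-x : ∀ {x} → x ≤ 0# → 0# ≤ - x
  x≤0⇒0≤-x {x} x≤0 = ≤-trans (x≤y⇒0≤y-x x≤0) (≤-reflexive (+-identityˡ (- x)))

  x*x-nonneg : ∀ x → 0# ≤ x * x
  x*x-nonneg x with total 0# x
  ... | inj₁ 0≤x = *-nonneg 0≤x 0≤x
  ... | inj₂ x≤0 = begin
    0#            ≤⟨ *-nonneg (x≤0⇒0≤-x x≤0) (x≤0⇒0≤-x x≤0) ⟩
    - x * - x     ≈⟨ -‿distribˡ-* x (- x) ⟨
    - (x * - x)   ≈⟨ -‿cong (-‿distribʳ-* x x) ⟨
    - - (x * x)   ≈⟨ -‿involutive (x * x) ⟩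
    x * x         ∎

  0≤1 : 0# ≤ 1#
  0≤1 = ≤-trans (x*x-nonneg 1#) (≤-reflexive (*-identityˡ 1#))

  1≰0 : ¬ 1# ≤ 0#
  1≰0 1≤0 = 0≉1 (antisym 0≤1 1≤0)

  fromℕ-nonneg : ∀ n → 0# ≤ fromℕ F n
  fromℕ-nonneg zero    = ≤-refl
  fromℕ-nonneg (suc n) = ≤-trans (≤-reflexive (sym (+-identityˡ 0#))) (+-mono-≤ 0≤1 (fromℕ-nonneg n))

  fromℕ-+ : ∀ m n → fromℕ F (m ℕ.+ n) ≈ fromℕ F m + fromℕ F n
  fromℕ-+ zero    n = sym (+-identityˡ _)
  fromℕ-+ (suc m) n = trans (+-congˡ (fromℕ-+ m n)) (sym (+-assoc 1# _ _))

  fromℕ-* : ∀ m n → fromℕ F (m ℕ.* n) ≈ fromℕ F m * fromℕ F n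
  fromℕ-* zero    n = sym (zeroˡ _)
  fromℕ-* (suc m) n = begin-equality
    fromℕ F (n ℕ.+ m ℕ.* n)             ≈⟨ fromℕ-+ n (m ℕ.* n) ⟩
    fromℕ F n + fromℕ F (m ℕ.* n)       ≈⟨ +-cong (sym (*-identityˡ _)) (fromℕ-* m n) ⟩
    1# * fromℕ F n + fromℕ F m * fromℕ F n ≈⟨ distribʳ (fromℕ F n) 1# (fromℕ F m) ⟨
    (1# + fromℕ F m) * fromℕ F n        ∎

  1≤fromℕ-suc : ∀ n → 1# ≤ fromℕ F (suc n)
  1≤fromℕ-suc n = ≤-trans (≤-reflexive (sym (+-identityʳ 1#))) (+-monoʳ-≤ 1# (fromℕ-nonneg n))

  fromℕ-reflects-≤ : ∀ m n → fromℕ F m ≤ fromℕ F n → m ℕ.≤ n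
  fromℕ-reflects-≤ zero    n       _     = ℕ.z≤n
  fromℕ-reflects-≤ (suc m) zero    fm≤0  = contradiction (≤-trans (1≤fromℕ-suc m) fm≤0) 1≰0
  fromℕ-reflects-≤ (suc m) (suc n) fm≤fn = ℕ.s≤s (fromℕ-reflects-≤ m n (+-cancelˡ-≤ 1# fm≤fn))

  fromℕ-suc≉0 : ∀ n → ¬ fromℕ F (suc n) ≈ 0#
  fromℕ-suc≉0 n fn≈0 = 1≰0 (≤-trans (1≤fromℕ-suc n) (≤-reflexive fn≈0))

  x⁻¹-nonneg : ∀ {x} → 0# ≤ x → ¬ x ≈ 0# → 0# ≤ x ⁻¹
  x⁻¹-nonneg {x} 0≤x x≉0 with total 0# (x ⁻¹)
  ... | inj₁ 0≤x⁻¹ = 0≤x⁻¹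
  ... | inj₂ x⁻¹≤0 = contradiction (begin
    1#          ≈⟨ ⁻¹-inverse x x≉0 ⟨
    x * x ⁻¹    ≤⟨ *-monoˡ-≤-nonneg 0≤x x⁻¹≤0 ⟩
    x * 0#      ≈⟨ zeroʳ x ⟩
    0#          ∎) 1≰0

  module Sum = SemiringSum semiring

  ∑≡sum : ∀ {n} (f : Fin n → Carrier) → ∑ F f ≡.≡ Sum.sum f
  ∑≡sum {zero}  f = ≡.refl
  ∑≡sum {suc n} f = ≡.cong (f zero +_) (∑≡sum (f ∘ suc))

  ∑∑≡sum-sum : ∀ {m n} (f : Fin m → Fin n → Carrier) →
               ∑ F (λ i → ∑ F (f i)) ≡.≡ Sum.sum (λ i → Sum.sum (f i))
  ∑∑≡sum-sum f = ≡.trans (∑≡sum (λ i → ∑ F (f i))) (Sum.sum-cong-≗ (λ i → ∑≡sum (f i)))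

  ∑-cong : ∀ {n} {f g : Fin n → Carrier} → (∀ i → f i ≈ g i) → ∑ F f ≈ ∑ F g
  ∑-cong {f = f} {g} f≈g = begin-equality
    ∑ F f       ≡⟨ ∑≡sum f ⟩
    Sum.sum f   ≈⟨ Sum.sum-cong-≋ f≈g ⟩
    Sum.sum g   ≡⟨ ∑≡sum g ⟨
    ∑ F g       ∎

  ∑-distrib-+ : ∀ {n} (f g : Fin n → Carrier) → ∑ F (λ i → f i + g i) ≈ ∑ F f + ∑ F g
  ∑-distrib-+ f g = begin-equality
    ∑ F (λ i → f i + g i)       ≡⟨ ∑≡sum (λ i → f i + g i) ⟩
    Sum.sum (λ i → f i + g i)   ≈⟨ Sum.∑-distrib-+ f g ⟩
    Sum.sum f + Sum.sum g       ≡⟨ ≡.cong₂ _+_ (∑≡sum f) (∑≡sum g) ⟨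
    ∑ F f + ∑ F g               ∎

  *-distribˡ-∑ : ∀ {n} x (f : Fin n → Carrier) → x * ∑ F f ≈ ∑ F (λ i → x * f i)
  *-distribˡ-∑ x f = begin-equality
    x * ∑ F f                   ≡⟨ ≡.cong (x *_) (∑≡sum f) ⟩
    x * Sum.sum f               ≈⟨ Sum.*-distribˡ-sum x f ⟩
    Sum.sum (λ i → x * f i)     ≡⟨ ∑≡sum (λ i → x * f i) ⟨
    ∑ F (λ i → x * f i)         ∎

  ∑-comm : ∀ {m n} (f : Fin m → Fin n → Carrier) →
           ∑ F (λ i → ∑ F (f i)) ≈ ∑ F (λ j → ∑ F (λ i → f i j))
  ∑-comm f = begin-equality
    ∑ F (λ i → ∑ F (f i))                     ≡⟨ ∑∑≡sum-sum f ⟩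
    Sum.sum (λ i → Sum.sum (f i))             ≈⟨ Sum.∑-comm f ⟩
    Sum.sum (λ j → Sum.sum (λ i → f i j))     ≡⟨ ∑∑≡sum-sum (λ j i → f i j) ⟨
    ∑ F (λ j → ∑ F (λ i → f i j))             ∎

  ∑-mono-≤ : ∀ {n} {f g : Fin n → Carrier} → (∀ i → f i ≤ g i) → ∑ F f ≤ ∑ F g
  ∑-mono-≤ {zero}  f≤g = ≤-refl
  ∑-mono-≤ {suc n} f≤g = +-mono-≤ (f≤g zero) (∑-mono-≤ (f≤g ∘ suc))

  ∑-nonneg : ∀ {n} {f : Fin n → Carrier} → (∀ i → 0# ≤ f i) → 0# ≤ ∑ F f
  ∑-nonneg {zero}  0≤f = ≤-refl
  ∑-nonneg {suc n} 0≤f = ≤-trans (≤-reflexive (sym (+-identityˡ 0#))) (+-mono-≤ (0≤f zero) (∑-nonneg (0≤f ∘ suc)))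

  x≤∑ : ∀ {n} {f : Fin n → Carrier} → (∀ i → 0# ≤ f i) → ∀ i → f i ≤ ∑ F f
  x≤∑ {suc n} {f} 0≤f zero = ≤-trans (≤-reflexive (sym (+-identityʳ (f zero))))
                                      (+-monoʳ-≤ (f zero) (∑-nonneg (0≤f ∘ suc)))
  x≤∑ {suc n} {f} 0≤f (suc i) = ≤-trans (≤-reflexive (sym (+-identityˡ (f (suc i)))))
                                         (+-mono-≤ (0≤f zero) (x≤∑ (0≤f ∘ suc) i))

  ∑∑-separable : ∀ {m n} (f : Fin m → Carrier) (g : Fin n → Carrier) →
                 ∑ F (λ i → ∑ F (λ j → f i * g j)) ≈ ∑ F f * ∑ F g
  ∑∑-separable f g = begin-equality
    ∑ F (λ i → ∑ F (λ j → f i * g j))   ≈⟨ ∑-cong (λ i → *-distribˡ-∑ (f i) g) ⟨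
    ∑ F (λ i → f i * ∑ F g)             ≈⟨ ∑-cong (λ i → *-comm (f i) (∑ F g)) ⟩
    ∑ F (λ i → ∑ F g * f i)             ≈⟨ *-distribˡ-∑ (∑ F g) f ⟨
    ∑ F g * ∑ F f                       ≈⟨ *-comm (∑ F g) (∑ F f) ⟩
    ∑ F f * ∑ F g                       ∎

  fromℕ-inverse : ∀ n .{{_ : ℕ.NonZero n}} → fromℕ F n * fromℕ F n ⁻¹ ≈ 1#
  fromℕ-inverse (suc n) = ⁻¹-inverse _ (fromℕ-suc≉0 n)

  fromℕ⁻¹-nonneg : ∀ n .{{_ : ℕ.NonZero n}} → 0# ≤ fromℕ F n ⁻¹
  fromℕ⁻¹-nonneg (suc n) = x⁻¹-nonneg (fromℕ-nonneg (suc n)) (fromℕ-suc≉0 n)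

  diagonal≤∑∑ : ∀ {m n} {f : Fin m → Fin n → Carrier} → (∀ a i → 0# ≤ f a i) →
                (σ : Fin n → Fin m) → ∑ F (λ i → f (σ i) i) ≤ ∑ F (λ a → ∑ F (λ i → f a i))
  diagonal≤∑∑ {f = f} 0≤f σ = begin
    ∑ F (λ i → f (σ i) i)             ≤⟨ ∑-mono-≤ (λ i → x≤∑ (λ a → 0≤f a i) (σ i)) ⟩
    ∑ F (λ i → ∑ F (λ a → f a i))     ≈⟨ ∑-comm (λ i a → f a i) ⟩
    ∑ F (λ a → ∑ F (λ i → f a i))     ∎

module DoublyStochasticMatrices {c ℓ : Level} (F : OrderedField c ℓ) where

  open HallMarriage
  open ThresholdArithmetic
  open import Data.Bool using (Bool; true; false; not)
  open import Data.Nat as ℕ using (zero; suc)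
  import Data.Nat.Properties as ℕ
  open import Data.Fin using (Fin; zero; suc)
  open import Data.Fin.Subset using (Subset; ∁; ∣_∣; _∈_)
  open import Data.Fin.Subset.Properties using (∣p∣≤n; ∣∁p∣≡n∸∣p∣)
  open import Data.Fin.Permutation using (Permutation′; _⟨$⟩ʳ_; id)
  open import Data.Vec using (_∷_; []; lookup; tabulate)
  open import Data.Vec.Properties using (lookup-map; lookup∘tabulate; []=⇒lookup; lookup⇒[]=)
  open import Data.Product using (Σ; proj₂)
  open import Data.Sum using (inj₁; inj₂)
  import Relation.Binary.PropositionalEquality as ≡
  import Algebra.Solver.CommutativeMonoid as CommutativeMonoidSolver

  open OrderedField F hiding (_≤_; zero)
  open OrderedFieldProperties F
  open CommutativeMonoidSolver *-commutativeMonoid using (solve; _⊜_; _⊕_)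

  𝟙 : Bool → Carrier
  𝟙 true  = 1#
  𝟙 false = 0#

  ∑-𝟙 : ∀ {n} (p : Subset n) → ∑ F (λ i → 𝟙 (lookup p i)) ≈ fromℕ F ∣ p ∣
  ∑-𝟙 []          = refl
  ∑-𝟙 (true ∷ p)  = +-congˡ (∑-𝟙 p)
  ∑-𝟙 (false ∷ p) = trans (+-identityˡ _) (∑-𝟙 p)

  ∑-𝟙-∁ : ∀ {n} (p : Subset n) → ∑ F (λ i → 𝟙 (not (lookup p i))) ≈ fromℕ F ∣ ∁ p ∣
  ∑-𝟙-∁ p = trans (∑-cong (λ i → reflexive (≡.cong 𝟙 (≡.sym (lookup-map i not p))))) (∑-𝟙 (∁ p))

  module _ {k : ℕ} {S : Matrix F k} (ds : DoublyStochastic F S) where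

    private
      rowSum = proj₁ (proj₂ ds)
      colSum = proj₂ (proj₂ ds)

    rowMass : (p : Subset k) → ∑ F (λ i → ∑ F (λ a → 𝟙 (lookup p a) * S a i)) ≈ fromℕ F ∣ p ∣
    rowMass p = begin-equality
      ∑ F (λ i → ∑ F (λ a → 𝟙 (lookup p a) * S a i))   ≈⟨ ∑-comm (λ i a → 𝟙 (lookup p a) * S a i) ⟩
      ∑ F (λ a → ∑ F (λ i → 𝟙 (lookup p a) * S a i))   ≈⟨ ∑-cong (λ a → *-distribˡ-∑ _ (S a)) ⟨
      ∑ F (λ a → 𝟙 (lookup p a) * ∑ F (S a))           ≈⟨ ∑-cong (λ a → trans (*-congˡ (rowSum a)) (*-identityʳ _)) ⟩
      ∑ F (λ a → 𝟙 (lookup p a))                       ≈⟨ ∑-𝟙 p ⟩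
      fromℕ F ∣ p ∣                                    ∎

    columnMass : (p : Subset k) → ∑ F (λ i → ∑ F (λ a → 𝟙 (lookup p i) * S a i)) ≈ fromℕ F ∣ p ∣
    columnMass p = begin-equality
      ∑ F (λ i → ∑ F (λ a → 𝟙 (lookup p i) * S a i))   ≈⟨ ∑-cong (λ i → *-distribˡ-∑ _ (λ a → S a i)) ⟨
      ∑ F (λ i → 𝟙 (lookup p i) * ∑ F (λ a → S a i))   ≈⟨ ∑-cong (λ i → trans (*-congˡ (colSum i)) (*-identityʳ _)) ⟩
      ∑ F (λ i → 𝟙 (lookup p i))                       ≈⟨ ∑-𝟙 p ⟩
      fromℕ F ∣ p ∣                                    ∎

  above : Carrier → Carrier → Bool
  above t x with total t x
  ... | inj₁ _ = true
  ... | inj₂ _ = false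

  above-true : ∀ {t x} → above t x ≡.≡ true → t ≤ x
  above-true {t} {x} eq with total t x
  ... | inj₁ t≤x = t≤x

  above-false : ∀ {t x} → above t x ≡.≡ false → x ≤ t
  above-false {t} {x} eq with total t x
  ... | inj₂ x≤t = x≤t

  -- _≤_ need not be decidable: totality picks, for each entry, a side of the threshold t,
  -- and the edge is kept exactly when t ≤ entry was picked.
  thresholdGraph : ∀ {k} → Carrier → Matrix F k → Graph k k
  thresholdGraph t S i = tabulate (λ a → above t (S a i))

  module _ {k : ℕ} {S : Matrix F k} {t : Carrier} where

    ∈thresholdGraph⁺ : ∀ {a i} → above t (S a i) ≡.≡ true → a ∈ thresholdGraph t S i
    ∈thresholdGraph⁺ {a} eq = lookup⇒[]= a _ (≡.trans (lookup∘tabulate _ a) eq)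

    ∈thresholdGraph⁻ : ∀ {a i} → a ∈ thresholdGraph t S i → t ≤ S a i
    ∈thresholdGraph⁻ {a} a∈ = above-true (≡.trans (≡.sym (lookup∘tabulate _ a)) ([]=⇒lookup a∈))

  𝟙-split : ∀ α β {s t} → 0# ≤ s → (α ≡.≡ true → β ≡.≡ false → s ≤ t) →
            𝟙 α * s ≤ 𝟙 β * s + 𝟙 α * (t * 𝟙 (not β))
  𝟙-split false β {s} {t} 0≤s _ = begin
    0# * s                          ≈⟨ zeroˡ s ⟩
    0#                              ≈⟨ +-identityʳ 0# ⟨
    0# + 0#                         ≤⟨ +-mono-≤ (*-nonneg (𝟙-nonneg β) 0≤s) ≤-refl ⟩
    𝟙 β * s + 0#                    ≈⟨ +-congˡ (zeroˡ _) ⟨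
    𝟙 β * s + 0# * (t * 𝟙 (not β))  ∎
    where
    𝟙-nonneg : ∀ b → 0# ≤ 𝟙 b
    𝟙-nonneg true  = 0≤1
    𝟙-nonneg false = ≤-refl
  𝟙-split true true {s} {t} _ _ = begin
    1# * s                  ≈⟨ +-identityʳ _ ⟨
    1# * s + 0#             ≈⟨ +-congˡ (trans (*-identityˡ _) (zeroʳ t)) ⟨
    1# * s + 1# * (t * 0#)  ∎
  𝟙-split true false {s} {t} _ s≤t = begin
    1# * s                  ≈⟨ *-identityˡ s ⟩
    s                       ≤⟨ s≤t ≡.refl ≡.refl ⟩
    t                       ≈⟨ trans (*-identityˡ _) (*-identityʳ t) ⟨
    1# * (t * 1#)           ≈⟨ +-identityˡ _ ⟨
    0# + 1# * (t * 1#)      ≈⟨ +-congʳ (zeroˡ s) ⟨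
    0# * s + 1# * (t * 1#)  ∎

  module _ {k : ℕ} {S : Matrix F k} (ds : DoublyStochastic F S) (t : Carrier) where

    private
      E = thresholdGraph t S

    -- An entry of a column in A either lies in a row of N(A) or is at most t.
    ∣A∣≤∣N[A]∣+∣A∣t∣∁N[A]∣ : (A : Subset k) →
      fromℕ F ∣ A ∣ ≤ fromℕ F ∣ N E A ∣ + fromℕ F ∣ A ∣ * (t * fromℕ F ∣ ∁ (N E A) ∣)
    ∣A∣≤∣N[A]∣+∣A∣t∣∁N[A]∣ A = begin
      fromℕ F ∣ A ∣                                     ≈⟨ columnMass ds A ⟨
      ∑ F (λ i → ∑ F (λ a → 𝟙 (α i) * S a i))           ≤⟨ ∑-mono-≤ (λ i → ∑-mono-≤ (λ a →
                                                             𝟙-split (α i) (β a) (proj₁ ds a i) (outside-≤t i a))) ⟩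
      ∑ F (λ i → ∑ F (λ a → inN a i + slack i a))       ≈⟨ ∑-cong (λ i → ∑-distrib-+ (λ a → inN a i) (slack i)) ⟩
      ∑ F (λ i → ∑ F (λ a → inN a i) + ∑ F (slack i))   ≈⟨ ∑-distrib-+ (λ i → ∑ F (λ a → inN a i)) (λ i → ∑ F (slack i)) ⟩
      ∑ F (λ i → ∑ F (λ a → inN a i)) + ∑ F (λ i → ∑ F (slack i))
                                                        ≈⟨ +-cong (rowMass ds (N E A)) total-slack ⟩
      fromℕ F ∣ N E A ∣ + fromℕ F ∣ A ∣ * (t * fromℕ F ∣ ∁ (N E A) ∣) ∎
      where
      α = lookup A
      β = lookup (N E A)
      inN : Fin k → Fin k → Carrier
      inN a i = 𝟙 (β a) * S a i
      slack : Fin k → Fin k → Carrier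
      slack i a = 𝟙 (α i) * (t * 𝟙 (not (β a)))

      edge⇒β≡true : ∀ i a → α i ≡.≡ true → above t (S a i) ≡.≡ true → β a ≡.≡ true
      edge⇒β≡true i a i∈A a∈Ei = []=⇒lookup (y∈N⁺ E (lookup⇒[]= i A i∈A) (∈thresholdGraph⁺ {S = S} a∈Ei))

      outside-≤t : ∀ i a → α i ≡.≡ true → β a ≡.≡ false → S a i ≤ t
      outside-≤t i a i∈A a∉N with above t (S a i) in a∈Ei
      ... | false = above-false a∈Ei
      ... | true with () ← ≡.trans (≡.sym (edge⇒β≡true i a i∈A a∈Ei)) a∉N

      total-slack : ∑ F (λ i → ∑ F (slack i)) ≈ fromℕ F ∣ A ∣ * (t * fromℕ F ∣ ∁ (N E A) ∣)
      total-slack = begin-equality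
        ∑ F (λ i → ∑ F (slack i))                          ≈⟨ ∑∑-separable (λ i → 𝟙 (α i)) (λ a → t * 𝟙 (not (β a))) ⟩
        ∑ F (λ i → 𝟙 (α i)) * ∑ F (λ a → t * 𝟙 (not (β a))) ≈⟨ *-cong (sym (∑-𝟙 A)) (*-distribˡ-∑ t (λ a → 𝟙 (not (β a)))) ⟨
        fromℕ F ∣ A ∣ * (t * ∑ F (λ a → 𝟙 (not (β a))))     ≈⟨ *-congˡ (*-congˡ (∑-𝟙-∁ (N E A))) ⟩
        fromℕ F ∣ A ∣ * (t * fromℕ F ∣ ∁ (N E A) ∣)         ∎

  module _ {k : ℕ} {S : Matrix F k} (ds : DoublyStochastic F S) where

    private
      t = fromℕ F (k ^ 2) ⁻¹
      E = thresholdGraph t S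

    thresholdGraph-Hall : 2 ℕ.≤ k → Hall E
    thresholdGraph-Hall 2≤k@(ℕ.s≤s _) A = threshold-arithmetic 2≤k (∣p∣≤n A)
      (≡.subst (λ m → k ^ 2 ℕ.* a ℕ.≤ k ^ 2 ℕ.* ν ℕ.+ a ℕ.* m) (∣∁p∣≡n∸∣p∣ (N E A)) scaled)
      where
      a = ∣ A ∣
      ν = ∣ N E A ∣
      ∁ν = ∣ ∁ (N E A) ∣
      K = fromℕ F (k ^ 2)

      K*[x+y*[t*z]]≈K*x+y*z : ∀ x y z → K * (x + y * (t * z)) ≈ K * x + y * z
      K*[x+y*[t*z]]≈K*x+y*z x y z = begin-equality
        K * (x + y * (t * z))       ≈⟨ distribˡ K x _ ⟩
        K * x + K * (y * (t * z))   ≈⟨ +-congˡ (solve 4 (λ K y t z → K ⊕ (y ⊕ (t ⊕ z)) ⊜ y ⊕ ((K ⊕ t) ⊕ z)) refl K y t z) ⟩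
        K * x + y * ((K * t) * z)   ≈⟨ +-congˡ (*-congˡ (trans (*-congʳ (fromℕ-inverse (k ^ 2))) (*-identityˡ z))) ⟩
        K * x + y * z               ∎

      scaled : k ^ 2 ℕ.* a ℕ.≤ k ^ 2 ℕ.* ν ℕ.+ a ℕ.* ∁ν
      scaled = fromℕ-reflects-≤ _ _ (begin
        fromℕ F (k ^ 2 ℕ.* a)                             ≈⟨ fromℕ-* (k ^ 2) a ⟩
        K * fromℕ F a                                     ≤⟨ *-monoˡ-≤-nonneg (fromℕ-nonneg (k ^ 2))
                                                               (∣A∣≤∣N[A]∣+∣A∣t∣∁N[A]∣ ds t A) ⟩
        K * (fromℕ F ν + fromℕ F a * (t * fromℕ F ∁ν))    ≈⟨ K*[x+y*[t*z]]≈K*x+y*z _ _ _ ⟩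
        K * fromℕ F ν + fromℕ F a * fromℕ F ∁ν            ≈⟨ +-cong (fromℕ-* (k ^ 2) ν) (fromℕ-* a ∁ν) ⟨
        fromℕ F (k ^ 2 ℕ.* ν) + fromℕ F (a ℕ.* ∁ν)        ≈⟨ fromℕ-+ (k ^ 2 ℕ.* ν) (a ℕ.* ∁ν) ⟨
        fromℕ F (k ^ 2 ℕ.* ν ℕ.+ a ℕ.* ∁ν)                ∎)

    largeDiagonal-2≤k : 2 ℕ.≤ k → Σ (Permutation′ k) λ π → ∀ i → t ≤ S (π ⟨$⟩ʳ i) i
    largeDiagonal-2≤k 2≤k
      with f , f∈E , f-injective ← Hall⇒Matching E (thresholdGraph-Hall 2≤k)
      with π , π≗f ← injective⇒permutation f f-injective
      = π , λ i → ≡.subst (λ a → t ≤ S a i) (≡.sym (π≗f i)) (∈thresholdGraph⁻ {S = S} {t} (f∈E i))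

  -- For k = 1 the threshold equals the only entry, which the threshold graph may miss.
  largeDiagonal : ∀ k {S : Matrix F k} → DoublyStochastic F S →
                  Σ (Permutation′ k) λ π → ∀ i → fromℕ F (k ^ 2) ⁻¹ ≤ S (π ⟨$⟩ʳ i) i
  largeDiagonal zero _ = id , λ ()
  largeDiagonal 1 {S} ds = id , λ { zero → ≤-reflexive (begin-equality
    fromℕ F 1 ⁻¹                ≈⟨ *-identityˡ _ ⟨
    1# * fromℕ F 1 ⁻¹           ≈⟨ *-congʳ (+-identityʳ 1#) ⟨
    fromℕ F 1 * fromℕ F 1 ⁻¹    ≈⟨ fromℕ-inverse 1 ⟩
    1#                          ≈⟨ proj₁ (proj₂ ds) zero ⟨
    S zero zero + 0#            ≈⟨ +-identityʳ _ ⟩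
    S zero zero                 ∎) }
  largeDiagonal (suc (suc _)) ds = largeDiagonal-2≤k ds (ℕ.s≤s (ℕ.s≤s ℕ.z≤n))

  module _ {k : ℕ} {S : Matrix F k} (0≤S : Nonnegative F S)
           {t : Carrier} (0≤t : 0# ≤ t) (σ : Fin k → Fin k) (t≤Sσ : ∀ i → t ≤ S (σ i) i)
           (cost : Fin k → Fin k → Fin k → Fin k → Carrier)
           (0≤cost : ∀ a a′ b b′ → 0# ≤ cost a a′ b b′) where

    private
      coupled : Fin k → Fin k → Fin k → Fin k → Carrier
      coupled a a′ b b′ = (cost a a′ b b′ * S a a′) * S b b′

      0≤coupled : ∀ a a′ b b′ → 0# ≤ coupled a a′ b b′
      0≤coupled a a′ b b′ = *-nonneg (*-nonneg (0≤cost a a′ b b′) (0≤S a a′)) (0≤S b b′)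

    diagonalCost≤couplingCost :
      (t * t) * ∑ F (λ i → ∑ F (λ j → cost (σ i) i (σ j) j)) ≤
      ∑ F (λ a → ∑ F (λ a′ → ∑ F (λ b → ∑ F (λ b′ → coupled a a′ b b′))))
    diagonalCost≤couplingCost = begin
      (t * t) * ∑ F (λ i → ∑ F (λ j → cost (σ i) i (σ j) j))
        ≈⟨ trans (*-distribˡ-∑ (t * t) (λ i → ∑ F (λ j → cost (σ i) i (σ j) j)))
                 (∑-cong (λ i → *-distribˡ-∑ (t * t) (λ j → cost (σ i) i (σ j) j))) ⟩
      ∑ F (λ i → ∑ F (λ j → (t * t) * cost (σ i) i (σ j) j))
        ≤⟨ ∑-mono-≤ (λ i → ∑-mono-≤ (λ j → termwise i j)) ⟩
      ∑ F (λ i → ∑ F (λ j → coupled (σ i) i (σ j) j))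
        ≤⟨ ∑-mono-≤ (λ i → diagonal≤∑∑ (0≤coupled (σ i) i) σ) ⟩
      ∑ F (λ i → ∑ F (λ b → ∑ F (λ b′ → coupled (σ i) i b b′)))
        ≤⟨ diagonal≤∑∑ (λ a a′ → ∑-nonneg (λ b → ∑-nonneg (0≤coupled a a′ b))) σ ⟩
      ∑ F (λ a → ∑ F (λ a′ → ∑ F (λ b → ∑ F (λ b′ → coupled a a′ b b′)))) ∎
      where
      termwise : ∀ i j → (t * t) * cost (σ i) i (σ j) j ≤ coupled (σ i) i (σ j) j
      termwise i j = begin
        (t * t) * cᵢⱼ                  ≈⟨ solve 2 (λ t c → (t ⊕ t) ⊕ c ⊜ (c ⊕ t) ⊕ t) refl t cᵢⱼ ⟩
        (cᵢⱼ * t) * t                  ≤⟨ *-monoʳ-≤-nonneg 0≤t (*-monoˡ-≤-nonneg (0≤cost _ _ _ _) (t≤Sσ i)) ⟩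
        (cᵢⱼ * S (σ i) i) * t          ≤⟨ *-monoˡ-≤-nonneg (*-nonneg (0≤cost _ _ _ _) (0≤S _ _)) (t≤Sσ j) ⟩
        (cᵢⱼ * S (σ i) i) * S (σ j) j  ∎
        where cᵢⱼ = cost (σ i) i (σ j) j

  t²P≤D⇒tP≤K²tD : ∀ {K t P D} → 0# ≤ K → 0# ≤ t → K * t ≈ 1# →
                  (t * t) * P ≤ D → t * P ≤ (K * K) * (t * D)
  t²P≤D⇒tP≤K²tD {K} {t} {P} {D} 0≤K 0≤t Kt≈1 t²P≤D = begin
    t * P                           ≈⟨ trans (*-congʳ Kt≈1) (*-identityˡ _) ⟨
    (K * t) * (t * P)               ≈⟨ trans (*-congʳ Kt≈1) (*-identityˡ _) ⟨
    (K * t) * ((K * t) * (t * P))   ≈⟨ solve 3 (λ K t P → (K ⊕ t) ⊕ ((K ⊕ t) ⊕ (t ⊕ P)) ⊜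
                                                          (K ⊕ K) ⊕ (t ⊕ ((t ⊕ t) ⊕ P))) refl K t P ⟩
    (K * K) * (t * ((t * t) * P))   ≤⟨ *-monoˡ-≤-nonneg (*-nonneg 0≤K 0≤K) (*-monoˡ-≤-nonneg 0≤t t²P≤D) ⟩
    (K * K) * (t * D)               ∎

  -- For k = 0 the normalisation 0⁻¹ is junk, but both sides are multiples of an empty sum.
  δp≤k⁴δds : ∀ {k} (B B₀ S : Matrix F k) → Nonnegative F S → (π : Permutation′ k) →
             (∀ i → fromℕ F (k ^ 2) ⁻¹ ≤ S (π ⟨$⟩ʳ i) i) →
             δp-at F B B₀ π ≤ fromℕ F (k ^ 4) * δds-at F B B₀ S
  δp≤k⁴δds {zero} B B₀ S _ _ _ = ≤-reflexive (trans (zeroʳ _) (sym (zeroˡ _)))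
  δp≤k⁴δds {k@(suc _)} B B₀ S 0≤S π t≤Sπ = begin
    δp-at F B B₀ π                      ≤⟨ t²P≤D⇒tP≤K²tD (fromℕ-nonneg (k ^ 2)) 0≤t (fromℕ-inverse (k ^ 2))
                                             (diagonalCost≤couplingCost 0≤S 0≤t (π ⟨$⟩ʳ_) t≤Sπ cost 0≤cost) ⟩
    (K * K) * δds-at F B B₀ S           ≈⟨ *-congʳ K*K≈fromℕ[k⁴] ⟩
    fromℕ F (k ^ 4) * δds-at F B B₀ S   ∎
    where
    K = fromℕ F (k ^ 2)
    0≤t = fromℕ⁻¹-nonneg (k ^ 2)
    cost : Fin k → Fin k → Fin k → Fin k → Carrier
    cost a a′ b b′ = sq F (B a b - B₀ a′ b′)
    0≤cost : ∀ a a′ b b′ → 0# ≤ cost a a′ b b′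
    0≤cost _ _ _ _ = x*x-nonneg _
    K*K≈fromℕ[k⁴] : K * K ≈ fromℕ F (k ^ 4)
    K*K≈fromℕ[k⁴] = sym (trans (reflexive (≡.cong (fromℕ F) (ℕ.^-distribˡ-+-* k 2 2))) (fromℕ-* (k ^ 2) (k ^ 2)))

open DoublyStochasticMatrices using (largeDiagonal; δp≤k⁴δds)

theoremE1 : {c ℓ : Level} (F : OrderedField c ℓ) (k : ℕ)
    (B B₀ : Matrix F k) →
    Symmetric F B → Nonnegative F B →
    Symmetric F B₀ → Nonnegative F B₀ →
    (S : Matrix F k) → DoublyStochastic F S →
    δp-≤ F B B₀ (OrderedField._*_ F (fromℕ F (k ^ 4)) (δds-at F B B₀ S))
theoremE1 F k B B₀ _ _ _ _ S ds with π , t≤Sπ ← largeDiagonal F k ds =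
  π , δp≤k⁴δds F B B₀ S (proj₁ ds) π t≤Sπ
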